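{- For $n\ge 1$, \[ L_n(x)=x\sum_{k=0}^{n-1}\binom{n-1}{k}C_n(n-1-k;1)(x-1)^k . \]
   Context: $L_n(x)=\sum_{k=1}^{n}\binom{n-1}{k-1}\frac{n!}{k!}(-x)^k$ (the Laguerre sequence, associated to the delta series $t/(t-1)$). For $a\neq0$, $C_n(x;a)=\sum_{k=0}^{n}\binom{n}{k}(-1)^{n-k}a^{ -k}(x)_k$ are the Poisson–Charlier polynomials, with $(x)_k=x(x-1)\cdots(x-k+1)$. -}

module Defs where

open import Data.Nat as ℕ using (ℕ; zero; suc; _!)
open import Data.Nat.DivMod as DM using ()
open import Data.Nat.Properties using (_!≢0)
open import Data.Nat.Combinatorics using (_C_)
open import Data.Integer using (ℤ; +_; -_; _+_; _*_; _-_; _^_)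

-- Σ[k=a..b] f k  (inclusive bounds; empty if b < a), as a finite sum over ℤ
sumFromTo : ℕ → ℕ → (ℕ → ℤ) → ℤ
sumFromTo a b f = go (suc b ℕ.∸ a)
  where
  go : ℕ → ℤ
  go zero = + 0
  go (suc m) = go m + f (a ℕ.+ m)

falling : ℤ → ℕ → ℤ
falling x zero = + 1
falling x (suc k) = falling x k * (x - + k)

factQuot : ℕ → ℕ → ℕ
factQuot n k = DM._/_ (n !) (k !) {{k !≢0}}

L : ℕ → ℤ → ℤ
L n x = sumFromTo 1 n (λ k → + (((n ℕ.∸ 1) C (k ℕ.∸ 1)) ℕ.* factQuot n k) * ((- x) ^ k))

C1 : ℕ → ℤ → ℤ
C1 n x = sumFromTo 0 n (λ k → + (n C k) * ((- + 1) ^ (n ℕ.∸ k)) * falling x k)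

module Submission where

-- Write n = m + 1, y = x - 1, and c_i = C(m+1,i) (-1)^(m+1-i), so that
-- C_{m+1}(a;1) = Σ_i c_i (a)_i.  Expanding the Charlier polynomials on the
-- right-hand side and exchanging the two summations gives
--   x Σ_i c_i Σ_k C(m,k) (m-k)_i y^k .
-- The absorption identity C(m,k) (m-k)_i = (m)_i C(m-i,k) and the binomial
-- theorem collapse the inner sum to (m)_i x^(m-i); the term i = m+1 vanishes
-- because (m)_(m+1) = 0.  Reindexing by j = m - i, the coefficient of x^(j+1)
-- is C(m+1,m-j) (m)_(m-j) (-1)^(j+1), and the factorial identity
-- C(m+1,m-j) (m)_(m-j) = C(m,j) (m+1)!/(j+1)! identifies it with the
-- coefficient of (-x)^(j+1) in L_{m+1}(x).

open import Defs
open import Data.Nat as ℕ using (ℕ; zero; suc; _≥_; _≤_; _<_; _∸_; _!; s≤s; _≤?_)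
import Data.Nat.Properties as ℕP
open import Data.Nat.Properties using (_!≢0; _!*_!≢0)
open import Data.Nat.Combinatorics
  using (_C_; nCk≡n!/k![n-k]!; k![n∸k]!∣n!; k>n⇒nCk≡0; nCk+nC[k+1]≡[n+1]C[k+1])
open import Data.Nat.Combinatorics.Base using (_P′_)
open import Data.Nat.Combinatorics.Specification using (nP′k≡n!/[n∸k]!)
open import Data.Nat.Divisibility using (m≤n⇒m!∣n!)
open import Data.Nat.DivMod using (m/n*n≡m)
import Data.Nat.Tactic.RingSolver as ℕ-Solver
open import Data.Integer using (ℤ; +_; -_; _+_; _*_; _-_; _^_)
import Data.Integer.Properties as ℤP
open import Data.Integer.Tactic.RingSolver using (solve-∀)
open import Data.Sum using (inj₁; inj₂)
open import Relation.Nullary using (yes; no)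
open import Relation.Binary.PropositionalEquality

∑ : ℕ → (ℕ → ℤ) → ℤ
∑ zero    f = + 0
∑ (suc N) f = ∑ N f + f N

sumFromTo0≡∑ : ∀ b f → sumFromTo 0 b f ≡ ∑ (suc b) f
sumFromTo0≡∑ zero    f = refl
sumFromTo0≡∑ (suc b) f = cong (_+ f (suc b)) (sumFromTo0≡∑ b f)

sumFromTo1≡∑ : ∀ n f → sumFromTo 1 n f ≡ ∑ n (λ i → f (suc i))
sumFromTo1≡∑ zero    f = refl
sumFromTo1≡∑ (suc n) f = cong (_+ f (suc n)) (sumFromTo1≡∑ n f)

∑-cong< : ∀ N {f g} → (∀ i → i < N → f i ≡ g i) → ∑ N f ≡ ∑ N g
∑-cong< zero    eq = refl
∑-cong< (suc N) eq =
  cong₂ _+_ (∑-cong< N (λ i i<N → eq i (ℕP.m<n⇒m<1+n i<N))) (eq N (ℕP.n<1+n N))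

∑-cong : ∀ N {f g} → (∀ i → f i ≡ g i) → ∑ N f ≡ ∑ N g
∑-cong N eq = ∑-cong< N (λ i _ → eq i)

∑-zero : ∀ N → ∑ N (λ _ → + 0) ≡ + 0
∑-zero zero    = refl
∑-zero (suc N) = cong (_+ + 0) (∑-zero N)

∑-+ : ∀ N f g → ∑ N (λ i → f i + g i) ≡ ∑ N f + ∑ N g
∑-+ zero    f g = refl
∑-+ (suc N) f g =
  trans (cong (_+ (f N + g N)) (∑-+ N f g)) (interchange (∑ N f) (∑ N g) (f N) (g N))
  where
  interchange : ∀ a b c d → (a + b) + (c + d) ≡ (a + c) + (b + d)
  interchange = solve-∀

∑-*ˡ : ∀ N c f → c * ∑ N f ≡ ∑ N (λ i → c * f i)
∑-*ˡ zero    c f = ℤP.*-zeroʳ c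
∑-*ˡ (suc N) c f = trans (ℤP.*-distribˡ-+ c (∑ N f) (f N)) (cong (_+ c * f N) (∑-*ˡ N c f))

∑-*ʳ : ∀ N f c → ∑ N f * c ≡ ∑ N (λ i → f i * c)
∑-*ʳ N f c =
  trans (ℤP.*-comm (∑ N f) c) (trans (∑-*ˡ N c f) (∑-cong N (λ i → ℤP.*-comm c (f i))))

∑-swap : ∀ A B (f : ℕ → ℕ → ℤ) →
         ∑ A (λ a → ∑ B (λ b → f a b)) ≡ ∑ B (λ b → ∑ A (λ a → f a b))
∑-swap zero    B f = sym (∑-zero B)
∑-swap (suc A) B f =
  trans (cong (_+ ∑ B (f A)) (∑-swap A B f)) (sym (∑-+ B (λ b → ∑ A (λ a → f a b)) (f A)))

∑-head : ∀ N f → ∑ (suc N) f ≡ f 0 + ∑ N (λ i → f (suc i))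
∑-head zero    f = ℤP.+-comm (+ 0) (f 0)
∑-head (suc N) f = trans (cong (_+ f (suc N)) (∑-head N f)) (ℤP.+-assoc (f 0) _ _)

∑-last-zero : ∀ N f → f N ≡ + 0 → ∑ (suc N) f ≡ ∑ N f
∑-last-zero N f fN≡0 = trans (cong (λ t → ∑ N f + t) fN≡0) (ℤP.+-identityʳ (∑ N f))

∑-reverse : ∀ m g → ∑ (suc m) g ≡ ∑ (suc m) (λ j → g (m ∸ j))
∑-reverse zero    g = refl
∑-reverse (suc m) g = begin
  ∑ (suc m) g + g (suc m)                              ≡⟨ cong (_+ g (suc m)) (∑-reverse m g) ⟩
  ∑ (suc m) (λ j → g (m ∸ j)) + g (suc m)              ≡⟨ ℤP.+-comm _ (g (suc m)) ⟩
  g (suc m) + ∑ (suc m) (λ j → g (m ∸ j))              ≡⟨ ∑-head (suc m) (λ j → g (suc m ∸ j)) ⟨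
  ∑ (suc (suc m)) (λ j → g (suc m ∸ j))                ∎
  where open ≡-Reasoning

binomialSum : ℤ → ℕ → ℕ → ℤ
binomialSum y a N = ∑ N (λ k → + (a C k) * y ^ k)

binomialSum-pascal : ∀ y a N →
  binomialSum y (suc a) (suc N) ≡ y * binomialSum y a N + binomialSum y a (suc N)
binomialSum-pascal y a N = begin
  binomialSum y (suc a) (suc N)
    ≡⟨ ∑-head N _ ⟩
  + 1 * + 1 + ∑ N (λ k → + (suc a C suc k) * y ^ suc k)
    ≡⟨ cong (_+_ (+ 1 * + 1)) (∑-cong N pascal) ⟩
  + 1 * + 1 + ∑ N (λ k → y * (+ (a C k) * y ^ k) + + (a C suc k) * y ^ suc k)
    ≡⟨ cong (_+_ (+ 1 * + 1)) (∑-+ N _ _) ⟩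
  + 1 * + 1 + (∑ N (λ k → y * (+ (a C k) * y ^ k)) + ∑ N (λ k → + (a C suc k) * y ^ suc k))
    ≡⟨ cong (λ s → + 1 * + 1 + (s + ∑ N (λ k → + (a C suc k) * y ^ suc k))) (∑-*ˡ N y _) ⟨
  + 1 * + 1 + (y * binomialSum y a N + ∑ N (λ k → + (a C suc k) * y ^ suc k))
    ≡⟨ regroup (y * binomialSum y a N) _ ⟩
  y * binomialSum y a N + (+ 1 * + 1 + ∑ N (λ k → + (a C suc k) * y ^ suc k))
    ≡⟨ cong (_+_ (y * binomialSum y a N)) (∑-head N _) ⟨
  y * binomialSum y a N + binomialSum y a (suc N) ∎
  where
  open ≡-Reasoning
  split : ∀ p q y w → (p + q) * (y * w) ≡ y * (p * w) + q * (y * w)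
  split = solve-∀
  pascal : ∀ k → + (suc a C suc k) * y ^ suc k ≡ y * (+ (a C k) * y ^ k) + + (a C suc k) * y ^ suc k
  pascal k = trans (cong (λ c → + c * y ^ suc k) (sym (nCk+nC[k+1]≡[n+1]C[k+1] a k)))
                   (split (+ (a C k)) (+ (a C suc k)) y (y ^ k))
  regroup : ∀ a b → + 1 * + 1 + (a + b) ≡ a + (+ 1 * + 1 + b)
  regroup = solve-∀

binomial : ∀ y a N → a < N → binomialSum y a N ≡ (+ 1 + y) ^ a
binomial y zero (suc N) _ = begin
  binomialSum y 0 (suc N)                 ≡⟨ ∑-head N _ ⟩
  + 1 + ∑ N (λ k → + 0 * y ^ suc k)       ≡⟨ cong (_+_ (+ 1)) (∑-cong N (λ k → ℤP.*-zeroˡ (y ^ suc k))) ⟩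
  + 1 + ∑ N (λ _ → + 0)                   ≡⟨ cong (_+_ (+ 1)) (∑-zero N) ⟩
  + 1                                     ∎
  where open ≡-Reasoning
binomial y (suc a) (suc N) (s≤s a<N) = begin
  binomialSum y (suc a) (suc N)                    ≡⟨ binomialSum-pascal y a N ⟩
  y * binomialSum y a N + binomialSum y a (suc N)  ≡⟨ cong₂ (λ u v → y * u + v) (binomial y a N a<N)
                                                            (binomial y a (suc N) (ℕP.m<n⇒m<1+n a<N)) ⟩
  y * (+ 1 + y) ^ a + (+ 1 + y) ^ a                ≡⟨ factor ((+ 1 + y) ^ a) y ⟩
  (+ 1 + y) ^ suc a                                ∎
  where
  open ≡-Reasoning
  factor : ∀ z y → y * z + z ≡ (+ 1 + y) * z
  factor = solve-∀

-- The library's m P′ i = (m ∸ (i-1)) ⋯ (m ∸ 0) is the falling factorial (m)_i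
-- for every i: once i > m it contains the factor m ∸ m = 0.
P′-vanishes : ∀ {m i} → m < i → m P′ i ≡ 0
P′-vanishes {m} {suc i} (s≤s m≤i) with ℕP.m≤n⇒m<n∨m≡n m≤i
... | inj₁ m<i  = trans (cong ((m ∸ i) ℕ.*_) (P′-vanishes m<i)) (ℕP.*-zeroʳ (m ∸ i))
... | inj₂ refl = cong (ℕ._* (m P′ m)) (ℕP.n∸n≡0 m)

falling-nat : ∀ m i → falling (+ m) i ≡ + (m P′ i)
falling-nat m zero = refl
falling-nat m (suc i) with i ≤? m
... | yes i≤m = begin
  falling (+ m) i * (+ m - + i)   ≡⟨ cong₂ _*_ (falling-nat m i) (trans (ℤP.m-n≡m⊖n m i) (ℤP.⊖-≥ i≤m)) ⟩
  + (m P′ i) * + (m ∸ i)          ≡⟨ ℤP.pos-* (m P′ i) (m ∸ i) ⟨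
  + ((m P′ i) ℕ.* (m ∸ i))        ≡⟨ cong +_ (ℕP.*-comm (m P′ i) (m ∸ i)) ⟩
  + (m P′ suc i)                  ∎
  where open ≡-Reasoning
... | no i≰m = begin
  falling (+ m) i * (+ m - + i)   ≡⟨ cong (_* (+ m - + i)) (trans (falling-nat m i) (cong +_ (P′-vanishes m<i))) ⟩
  + 0 * (+ m - + i)               ≡⟨ ℤP.*-zeroˡ (+ m - + i) ⟩
  + 0                             ≡⟨ cong +_ (P′-vanishes (ℕP.m<n⇒m<1+n m<i)) ⟨
  + (m P′ suc i)                  ∎
  where
  open ≡-Reasoning
  m<i : m < i
  m<i = ℕP.≰⇒> i≰m

P′-factorial : ∀ {m i} → i ≤ m → (m P′ i) ℕ.* (m ∸ i) ! ≡ m !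
P′-factorial {m} {i} i≤m =
  trans (cong (ℕ._* (m ∸ i) !) (nP′k≡n!/[n∸k]! i≤m))
        (m/n*n≡m {{(m ∸ i) !≢0}} (m≤n⇒m!∣n! (ℕP.m∸n≤m m i)))

C-factorial : ∀ {n k} → k ≤ n → (n C k) ℕ.* (k ! ℕ.* (n ∸ k) !) ≡ n !
C-factorial {n} {k} k≤n =
  trans (cong (ℕ._* (k ! ℕ.* (n ∸ k) !)) (nCk≡n!/k![n-k]! k≤n))
        (m/n*n≡m {{k !* (n ∸ k) !≢0}} (k![n∸k]!∣n! k≤n))

factQuot-factorial : ∀ {n k} → k ≤ n → factQuot n k ℕ.* k ! ≡ n !
factQuot-factorial {n} {k} k≤n = m/n*n≡m {{k !≢0}} (m≤n⇒m!∣n! k≤n)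

cancel-by : ∀ {a b N} d .{{_ : ℕ.NonZero d}} → a ℕ.* d ≡ N → b ℕ.* d ≡ N → a ≡ b
cancel-by {a} {b} d a*d≡N b*d≡N = ℕP.*-cancelʳ-≡ a b d (trans a*d≡N (sym b*d≡N))

-- Absorption: C(m,k) (m-k)_i = (m)_i C(m-i,k).  If i + k ≤ m both sides times
-- k! (m-k-i)! equal m!; otherwise both sides vanish.
absorption : ∀ m k i → (m C k) ℕ.* ((m ∸ k) P′ i) ≡ (m P′ i) ℕ.* ((m ∸ i) C k)
absorption m k i with i ℕ.+ k ≤? m
... | yes i+k≤m = cancel-by (k ! ℕ.* (m ∸ k ∸ i) !) {{k !* (m ∸ k ∸ i) !≢0}} lhs rhs
  where
  open ≡-Reasoning
  k≤m : k ≤ m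
  k≤m = ℕP.≤-trans (ℕP.m≤n+m k i) i+k≤m
  i≤m : i ≤ m
  i≤m = ℕP.≤-trans (ℕP.m≤m+n i k) i+k≤m
  i≤m∸k : i ≤ m ∸ k
  i≤m∸k = subst (_≤ m ∸ k) (ℕP.m+n∸n≡m i k) (ℕP.∸-monoˡ-≤ k i+k≤m)
  k≤m∸i : k ≤ m ∸ i
  k≤m∸i = subst (_≤ m ∸ i) (ℕP.m+n∸m≡n i k) (ℕP.∸-monoˡ-≤ i i+k≤m)
  ∸-swap : m ∸ k ∸ i ≡ m ∸ i ∸ k
  ∸-swap = trans (ℕP.∸-+-assoc m k i) (trans (cong (m ∸_) (ℕP.+-comm k i)) (sym (ℕP.∸-+-assoc m i k)))
  shuffle : ∀ a b c d → a ℕ.* b ℕ.* (c ℕ.* d) ≡ a ℕ.* (c ℕ.* (b ℕ.* d))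
  shuffle = ℕ-Solver.solve-∀
  assoc : ∀ a b c d → a ℕ.* b ℕ.* (c ℕ.* d) ≡ a ℕ.* (b ℕ.* (c ℕ.* d))
  assoc = ℕ-Solver.solve-∀
  lhs : (m C k) ℕ.* ((m ∸ k) P′ i) ℕ.* (k ! ℕ.* (m ∸ k ∸ i) !) ≡ m !
  lhs = begin
    (m C k) ℕ.* ((m ∸ k) P′ i) ℕ.* (k ! ℕ.* (m ∸ k ∸ i) !)    ≡⟨ shuffle (m C k) ((m ∸ k) P′ i) (k !) ((m ∸ k ∸ i) !) ⟩
    (m C k) ℕ.* (k ! ℕ.* (((m ∸ k) P′ i) ℕ.* (m ∸ k ∸ i) !))  ≡⟨ cong (λ t → (m C k) ℕ.* (k ! ℕ.* t)) (P′-factorial i≤m∸k) ⟩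
    (m C k) ℕ.* (k ! ℕ.* (m ∸ k) !)                           ≡⟨ C-factorial k≤m ⟩
    m !                                                       ∎
  rhs : (m P′ i) ℕ.* ((m ∸ i) C k) ℕ.* (k ! ℕ.* (m ∸ k ∸ i) !) ≡ m !
  rhs = begin
    (m P′ i) ℕ.* ((m ∸ i) C k) ℕ.* (k ! ℕ.* (m ∸ k ∸ i) !)    ≡⟨ cong (λ t → (m P′ i) ℕ.* ((m ∸ i) C k) ℕ.* (k ! ℕ.* t !)) ∸-swap ⟩
    (m P′ i) ℕ.* ((m ∸ i) C k) ℕ.* (k ! ℕ.* (m ∸ i ∸ k) !)    ≡⟨ assoc (m P′ i) ((m ∸ i) C k) (k !) ((m ∸ i ∸ k) !) ⟩
    (m P′ i) ℕ.* (((m ∸ i) C k) ℕ.* (k ! ℕ.* (m ∸ i ∸ k) !))  ≡⟨ cong ((m P′ i) ℕ.*_) (C-factorial k≤m∸i) ⟩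
    (m P′ i) ℕ.* (m ∸ i) !                                    ≡⟨ P′-factorial i≤m ⟩
    m !                                                       ∎
... | no i+k≰m = trans lhs≡0 (sym rhs≡0)
  where
  m<i+k : m < i ℕ.+ k
  m<i+k = ℕP.≰⇒> i+k≰m
  ∸-<ˡ : ∀ {a b} → b ≤ m → m < a ℕ.+ b → m ∸ b < a
  ∸-<ˡ {a} {b} b≤m m<a+b = ℕP.+-cancelʳ-< b (m ∸ b) a (subst (_< a ℕ.+ b) (sym (ℕP.m∸n+n≡m b≤m)) m<a+b)
  lhs≡0 : (m C k) ℕ.* ((m ∸ k) P′ i) ≡ 0
  lhs≡0 with k ≤? m
  ... | yes k≤m = trans (cong ((m C k) ℕ.*_) (P′-vanishes (∸-<ˡ k≤m m<i+k))) (ℕP.*-zeroʳ (m C k))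
  ... | no k≰m  = cong (ℕ._* ((m ∸ k) P′ i)) (k>n⇒nCk≡0 (ℕP.≰⇒> k≰m))
  rhs≡0 : (m P′ i) ℕ.* ((m ∸ i) C k) ≡ 0
  rhs≡0 with i ≤? m
  ... | yes i≤m = trans (cong ((m P′ i) ℕ.*_) (k>n⇒nCk≡0 (∸-<ˡ i≤m (subst (m <_) (ℕP.+-comm i k) m<i+k))))
                        (ℕP.*-zeroʳ (m P′ i))
  ... | no i≰m  = cong (ℕ._* ((m ∸ i) C k)) (P′-vanishes (ℕP.≰⇒> i≰m))

-- The Laguerre coefficient in Charlier form:
-- C(m,j) (m+1)!/(j+1)! = C(m+1,m-j) (m)_(m-j)  for j ≤ m; both sides times
-- j! (m-j)! (j+1)! equal m! (m+1)!.
laguerreCoeff-charlier : ∀ m j → j ≤ m →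
  (m C j) ℕ.* factQuot (suc m) (suc j) ≡ (suc m C (m ∸ j)) ℕ.* (m P′ (m ∸ j))
laguerreCoeff-charlier m j j≤m =
  cancel-by (j ! ℕ.* (m ∸ j) ! ℕ.* (suc j) !) {{ℕP.m*n≢0 _ _ {{j !* (m ∸ j) !≢0}} {{(suc j) !≢0}}}} lhs rhs
  where
  open ≡-Reasoning
  m∸j≤m : m ∸ j ≤ m
  m∸j≤m = ℕP.m∸n≤m m j
  m∸[m∸j]≡j : m ∸ (m ∸ j) ≡ j
  m∸[m∸j]≡j = ℕP.m∸[m∸n]≡n j≤m
  1+m∸[m∸j]≡1+j : suc m ∸ (m ∸ j) ≡ suc j
  1+m∸[m∸j]≡1+j = trans (ℕP.+-∸-assoc 1 m∸j≤m) (cong suc m∸[m∸j]≡j)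
  regroupˡ : ∀ a b c d e → a ℕ.* b ℕ.* (c ℕ.* d ℕ.* e) ≡ a ℕ.* (c ℕ.* d) ℕ.* (b ℕ.* e)
  regroupˡ = ℕ-Solver.solve-∀
  regroupʳ : ∀ a b c d e → a ℕ.* b ℕ.* (c ℕ.* d ℕ.* e) ≡ a ℕ.* (d ℕ.* e) ℕ.* (b ℕ.* c)
  regroupʳ = ℕ-Solver.solve-∀
  lhs : (m C j) ℕ.* factQuot (suc m) (suc j) ℕ.* (j ! ℕ.* (m ∸ j) ! ℕ.* (suc j) !) ≡ m ! ℕ.* (suc m) !
  lhs = begin
    (m C j) ℕ.* factQuot (suc m) (suc j) ℕ.* (j ! ℕ.* (m ∸ j) ! ℕ.* (suc j) !)
      ≡⟨ regroupˡ (m C j) (factQuot (suc m) (suc j)) (j !) ((m ∸ j) !) ((suc j) !) ⟩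
    (m C j) ℕ.* (j ! ℕ.* (m ∸ j) !) ℕ.* (factQuot (suc m) (suc j) ℕ.* (suc j) !)
      ≡⟨ cong₂ ℕ._*_ (C-factorial j≤m) (factQuot-factorial (s≤s j≤m)) ⟩
    m ! ℕ.* (suc m) ! ∎
  rhs : (suc m C (m ∸ j)) ℕ.* (m P′ (m ∸ j)) ℕ.* (j ! ℕ.* (m ∸ j) ! ℕ.* (suc j) !) ≡ m ! ℕ.* (suc m) !
  rhs = begin
    (suc m C (m ∸ j)) ℕ.* (m P′ (m ∸ j)) ℕ.* (j ! ℕ.* (m ∸ j) ! ℕ.* (suc j) !)
      ≡⟨ regroupʳ (suc m C (m ∸ j)) (m P′ (m ∸ j)) (j !) ((m ∸ j) !) ((suc j) !) ⟩
    (suc m C (m ∸ j)) ℕ.* ((m ∸ j) ! ℕ.* (suc j) !) ℕ.* ((m P′ (m ∸ j)) ℕ.* j !)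
      ≡⟨ cong₂ (λ u v → (suc m C (m ∸ j)) ℕ.* ((m ∸ j) ! ℕ.* u !) ℕ.* ((m P′ (m ∸ j)) ℕ.* v !))
               (sym 1+m∸[m∸j]≡1+j) (sym m∸[m∸j]≡j) ⟩
    (suc m C (m ∸ j)) ℕ.* ((m ∸ j) ! ℕ.* (suc m ∸ (m ∸ j)) !) ℕ.* ((m P′ (m ∸ j)) ℕ.* (m ∸ (m ∸ j)) !)
      ≡⟨ cong₂ ℕ._*_ (C-factorial (ℕP.m≤n⇒m≤1+n m∸j≤m)) (P′-factorial m∸j≤m) ⟩
    (suc m) ! ℕ.* m !
      ≡⟨ ℕP.*-comm ((suc m) !) (m !) ⟩
    m ! ℕ.* (suc m) ! ∎

-- The coefficients of C_n(x;1) in the falling-factorial basis: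
-- C_n(x;1) = Σ_i charlierCoeff n i (x)_i.
charlierCoeff : ℕ → ℕ → ℤ
charlierCoeff n i = + (n C i) * (- + 1) ^ (n ∸ i)

C1-nat : ∀ n a → C1 n (+ a) ≡ ∑ (suc n) (λ i → charlierCoeff n i * + (a P′ i))
C1-nat n a = trans (sumFromTo0≡∑ n _) (∑-cong (suc n) (λ i → cong (charlierCoeff n i *_) (falling-nat a i)))

fallingBinomialSum : ∀ m i y →
  ∑ (suc m) (λ k → + (m C k) * + ((m ∸ k) P′ i) * y ^ k) ≡ + (m P′ i) * (+ 1 + y) ^ (m ∸ i)
fallingBinomialSum m i y = begin
  ∑ (suc m) (λ k → + (m C k) * + ((m ∸ k) P′ i) * y ^ k)
    ≡⟨ ∑-cong (suc m) absorbed ⟩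
  ∑ (suc m) (λ k → + (m P′ i) * (+ ((m ∸ i) C k) * y ^ k))
    ≡⟨ ∑-*ˡ (suc m) (+ (m P′ i)) _ ⟨
  + (m P′ i) * binomialSum y (m ∸ i) (suc m)
    ≡⟨ cong (+ (m P′ i) *_) (binomial y (m ∸ i) (suc m) (s≤s (ℕP.m∸n≤m m i))) ⟩
  + (m P′ i) * (+ 1 + y) ^ (m ∸ i) ∎
  where
  open ≡-Reasoning
  absorbed : ∀ k → + (m C k) * + ((m ∸ k) P′ i) * y ^ k ≡ + (m P′ i) * (+ ((m ∸ i) C k) * y ^ k)
  absorbed k = begin
    + (m C k) * + ((m ∸ k) P′ i) * y ^ k      ≡⟨ cong (_* y ^ k) (ℤP.pos-* (m C k) ((m ∸ k) P′ i)) ⟨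
    + ((m C k) ℕ.* ((m ∸ k) P′ i)) * y ^ k    ≡⟨ cong (λ c → + c * y ^ k) (absorption m k i) ⟩
    + ((m P′ i) ℕ.* ((m ∸ i) C k)) * y ^ k    ≡⟨ cong (_* y ^ k) (ℤP.pos-* (m P′ i) ((m ∸ i) C k)) ⟩
    + (m P′ i) * + ((m ∸ i) C k) * y ^ k      ≡⟨ ℤP.*-assoc (+ (m P′ i)) _ _ ⟩
    + (m P′ i) * (+ ((m ∸ i) C k) * y ^ k)    ∎

collapsedTerm : ℕ → ℤ → ℕ → ℤ
collapsedTerm m x i = charlierCoeff (suc m) i * (+ (m P′ i) * x ^ (m ∸ i))

charlierSum-collapse : ∀ m x →
  ∑ (suc m) (λ k → + (m C k) * C1 (suc m) (+ (m ∸ k)) * (x - + 1) ^ k) ≡ ∑ (suc m) (collapsedTerm m x)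
charlierSum-collapse m x = begin
  ∑ (suc m) (λ k → + (m C k) * C1 (suc m) (+ (m ∸ k)) * y ^ k)
    ≡⟨ ∑-cong (suc m) expand ⟩
  ∑ (suc m) (λ k → ∑ (suc (suc m)) (λ i → c i * T k i))
    ≡⟨ ∑-swap (suc m) (suc (suc m)) _ ⟩
  ∑ (suc (suc m)) (λ i → ∑ (suc m) (λ k → c i * T k i))
    ≡⟨ ∑-cong (suc (suc m)) (λ i → sym (∑-*ˡ (suc m) (c i) (λ k → T k i))) ⟩
  ∑ (suc (suc m)) (λ i → c i * ∑ (suc m) (λ k → T k i))
    ≡⟨ ∑-cong (suc (suc m)) (λ i → cong (c i *_) (fallingBinomialSum m i y)) ⟩
  ∑ (suc (suc m)) (λ i → c i * (+ (m P′ i) * (+ 1 + y) ^ (m ∸ i)))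
    ≡⟨ ∑-cong (suc (suc m)) (λ i → cong (λ z → c i * (+ (m P′ i) * z ^ (m ∸ i))) (1+[x-1]≡x x)) ⟩
  ∑ (suc (suc m)) (collapsedTerm m x)
    ≡⟨ ∑-last-zero (suc m) (collapsedTerm m x) lastTerm≡0 ⟩
  ∑ (suc m) (collapsedTerm m x) ∎
  where
  open ≡-Reasoning
  y = x - + 1
  c = charlierCoeff (suc m)
  T : ℕ → ℕ → ℤ
  T k i = + (m C k) * + ((m ∸ k) P′ i) * y ^ k
  1+[x-1]≡x : ∀ x → + 1 + (x - + 1) ≡ x
  1+[x-1]≡x = solve-∀
  distribute : ∀ a s b → a * s * b ≡ s * (a * b)
  distribute = solve-∀
  regroup : ∀ q f a b → q * f * (a * b) ≡ q * (a * f * b)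
  regroup = solve-∀
  expand : ∀ k → + (m C k) * C1 (suc m) (+ (m ∸ k)) * y ^ k ≡ ∑ (suc (suc m)) (λ i → c i * T k i)
  expand k = begin
    + (m C k) * C1 (suc m) (+ (m ∸ k)) * y ^ k
      ≡⟨ cong (λ s → + (m C k) * s * y ^ k) (C1-nat (suc m) (m ∸ k)) ⟩
    + (m C k) * ∑ (suc (suc m)) F * y ^ k
      ≡⟨ distribute (+ (m C k)) (∑ (suc (suc m)) F) (y ^ k) ⟩
    ∑ (suc (suc m)) F * (+ (m C k) * y ^ k)
      ≡⟨ ∑-*ʳ (suc (suc m)) F _ ⟩
    ∑ (suc (suc m)) (λ i → F i * (+ (m C k) * y ^ k))
      ≡⟨ ∑-cong (suc (suc m)) (λ i → regroup (c i) (+ ((m ∸ k) P′ i)) (+ (m C k)) (y ^ k)) ⟩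
    ∑ (suc (suc m)) (λ i → c i * T k i) ∎
    where
    F : ℕ → ℤ
    F i = c i * + ((m ∸ k) P′ i)
  lastTerm≡0 : collapsedTerm m x (suc m) ≡ + 0
  lastTerm≡0 = begin
    c (suc m) * (+ (m P′ suc m) * x ^ (m ∸ suc m))  ≡⟨ cong (λ p → c (suc m) * (+ p * x ^ (m ∸ suc m))) (P′-vanishes (ℕP.n<1+n m)) ⟩
    c (suc m) * (+ 0 * x ^ (m ∸ suc m))             ≡⟨ cong (c (suc m) *_) (ℤP.*-zeroˡ (x ^ (m ∸ suc m))) ⟩
    c (suc m) * + 0                                 ≡⟨ ℤP.*-zeroʳ (c (suc m)) ⟩
    + 0                                             ∎

neg-pow : ∀ j x → (- x) ^ j ≡ (- + 1) ^ j * x ^ j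
neg-pow zero    x = refl
neg-pow (suc j) x = trans (cong ((- x) *_) (neg-pow j x)) (step x ((- + 1) ^ j) (x ^ j))
  where
  step : ∀ x a b → (- x) * (a * b) ≡ ((- + 1) * a) * (x * b)
  step = solve-∀

collapsedTerm≡laguerreTerm : ∀ m x j → j < suc m →
  x * collapsedTerm m x (m ∸ j) ≡ + ((m C j) ℕ.* factQuot (suc m) (suc j)) * (- x) ^ suc j
collapsedTerm≡laguerreTerm m x j (s≤s j≤m) = begin
  x * (+ (suc m C i) * (- + 1) ^ (suc m ∸ i) * (+ (m P′ i) * x ^ (m ∸ i)))
    ≡⟨ cong₂ (λ u v → x * (+ (suc m C i) * (- + 1) ^ u * (+ (m P′ i) * x ^ v))) 1+m∸i≡1+j m∸i≡j ⟩
  x * (+ (suc m C i) * (- + 1) ^ suc j * (+ (m P′ i) * x ^ j))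
    ≡⟨ regroup x (+ (suc m C i)) ((- + 1) ^ j) (+ (m P′ i)) (x ^ j) ⟩
  + (suc m C i) * + (m P′ i) * ((- + 1) ^ suc j * x ^ suc j)
    ≡⟨ cong₂ _*_ (ℤP.pos-* (suc m C i) (m P′ i)) (neg-pow (suc j) x) ⟨
  + ((suc m C i) ℕ.* (m P′ i)) * (- x) ^ suc j
    ≡⟨ cong (λ a → + a * (- x) ^ suc j) (laguerreCoeff-charlier m j j≤m) ⟨
  + ((m C j) ℕ.* factQuot (suc m) (suc j)) * (- x) ^ suc j ∎
  where
  open ≡-Reasoning
  i = m ∸ j
  m∸i≡j : m ∸ i ≡ j
  m∸i≡j = ℕP.m∸[m∸n]≡n j≤m
  1+m∸i≡1+j : suc m ∸ i ≡ suc j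
  1+m∸i≡1+j = trans (ℕP.+-∸-assoc 1 (ℕP.m∸n≤m m j)) (cong suc m∸i≡j)
  regroup : ∀ x c s f p → x * (c * ((- + 1) * s) * (f * p)) ≡ c * f * (((- + 1) * s) * (x * p))
  regroup = solve-∀

theorem5 : (n : ℕ) → n ≥ 1 → (x : ℤ) →
    L n x ≡ x * sumFromTo 0 (n ℕ.∸ 1)
      (λ k → + ((n ℕ.∸ 1) C k) * C1 n (+ (n ℕ.∸ 1 ℕ.∸ k)) * ((x - + 1) ^ k))
theorem5 (suc m) _ x = sym (begin
  x * sumFromTo 0 m (λ k → + (m C k) * C1 (suc m) (+ (m ∸ k)) * (x - + 1) ^ k)
    ≡⟨ cong (x *_) (trans (sumFromTo0≡∑ m _) (charlierSum-collapse m x)) ⟩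
  x * ∑ (suc m) (collapsedTerm m x)
    ≡⟨ cong (x *_) (∑-reverse m (collapsedTerm m x)) ⟩
  x * ∑ (suc m) (λ j → collapsedTerm m x (m ∸ j))
    ≡⟨ ∑-*ˡ (suc m) x _ ⟩
  ∑ (suc m) (λ j → x * collapsedTerm m x (m ∸ j))
    ≡⟨ ∑-cong< (suc m) (collapsedTerm≡laguerreTerm m x) ⟩
  ∑ (suc m) (λ j → + ((m C j) ℕ.* factQuot (suc m) (suc j)) * (- x) ^ suc j)
    ≡⟨ sumFromTo1≡∑ (suc m) _ ⟨
  L (suc m) x ∎)
  where open ≡-Reasoning
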